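{- Let $q=2^m$ with $m$ a positive integer, let $a\in\mathbb{F}_q^*$ with $a\neq1$ and $\mathrm{Tr}(1/a)=\mathrm{Tr}(1)$, let $b\in\mathbb{F}_q$ satisfy $b^2+b+1=1/a$, let $\omega\in\mathbb{F}_4\setminus\mathbb{F}_2$, and put $c:=(b+\omega)/(b+\omega^2)$. Define $f_0(X):=X^3+X+a$, $f_1(X):=ab^2X^3+X^2+a(b+1)^2X+a^2b^4$, and $f_2(X):=a(b+1)^2X^3+X^2+ab^2X+a^2(b+1)^4$. Then for each $i\in\{0,1,2\}$, $f_i(X)$ has three distinct roots in $\mathbb{F}_q$ if $\omega^ic$ is a cube in $\mathbb{F}_{q^2}$, and $f_i(X)$ is irreducible in $\mathbb{F}_q[X]$ otherwise.
   Context: $\mathrm{Tr}$ denotes the trace map from $\mathbb{F}_q$ to $\mathbb{F}_2$. All fields are viewed inside a fixed algebraic closure of $\mathbb{F}_2$. -}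

module Defs where

open import Level using (_⊔_)
open import Data.Nat using (ℕ; zero; suc)
import Data.Nat as ℕ
open import Data.Fin using (Fin; zero; suc; toℕ)
open import Data.List using (List; []; _∷_; map)
open import Data.List.Relation.Unary.All using (All)
open import Data.Product using (Σ; ∃; _×_; _,_)
open import Data.Sum using (_⊎_)
open import Relation.Nullary using (¬_)
open import Relation.Binary.PropositionalEquality using (_≡_)
open import Algebra.Bundles using (CommutativeRing; Semiring)

module FF {c ℓ} (R : CommutativeRing c ℓ) where
  open CommutativeRing R
  open import Algebra.Definitions.RawSemiring (Semiring.rawSemiring semiring) public using (_^_)

  record IsField : Set (c ⊔ ℓ) where
    field
      0≉1 : ¬ (0# ≈ 1#)
      inverse : ∀ x → ¬ (x ≈ 0#) → ∃ λ y → x * y ≈ 1#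

  record HasCard (n : ℕ) : Set (c ⊔ ℓ) where
    field
      enum : Fin n → Carrier
      enum-inj : ∀ i j → enum i ≈ enum j → i ≡ j
      enum-surj : ∀ x → ∃ λ i → enum i ≈ x

  -- membership in the subfield F_{2^k} = { x | x^(2^k) = x }
  InSub : ℕ → Carrier → Set ℓ
  InSub k x = x ^ (2 ℕ.^ k) ≈ x

  Tr : ℕ → Carrier → Carrier
  Tr zero x = 0#
  Tr (suc j) x = Tr j x + x ^ (2 ℕ.^ j)

  -- polynomials as coefficient lists, constant term first
  Poly : Set c
  Poly = List Carrier

  coeff : Poly → ℕ → Carrier
  coeff [] n = 0#
  coeff (a ∷ p) zero = a
  coeff (a ∷ p) (suc n) = coeff p n

  _≃_ : Poly → Poly → Set ℓ
  p ≃ r = ∀ n → coeff p n ≈ coeff r n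

  _⊕_ : Poly → Poly → Poly
  [] ⊕ r = r
  (a ∷ p) ⊕ [] = a ∷ p
  (a ∷ p) ⊕ (b ∷ r) = (a + b) ∷ (p ⊕ r)

  _⊛_ : Poly → Poly → Poly
  [] ⊛ r = []
  (a ∷ p) ⊛ r = map (a *_) r ⊕ (0# ∷ (p ⊛ r))

  eval : Poly → Carrier → Carrier
  eval [] x = 0#
  eval (a ∷ p) x = a + x * eval p x

  PolyOver : ℕ → Poly → Set (c ⊔ ℓ)
  PolyOver k p = All (InSub k) p

  IsUnit : ℕ → Poly → Set (c ⊔ ℓ)
  IsUnit k p = ∃ λ r → PolyOver k r × ((p ⊛ r) ≃ (1# ∷ []))

  Irreducible : ℕ → Poly → Set (c ⊔ ℓ)
  Irreducible k f =
    ¬ (f ≃ []) × ¬ IsUnit k f ×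
    (∀ g h → PolyOver k g → PolyOver k h → f ≃ (g ⊛ h) → IsUnit k g ⊎ IsUnit k h)

  ThreeDistinctRoots : ℕ → Poly → Set (c ⊔ ℓ)
  ThreeDistinctRoots k f =
    Σ Carrier λ r₁ → Σ Carrier λ r₂ → Σ Carrier λ r₃ →
      InSub k r₁ × InSub k r₂ × InSub k r₃ ×
      ¬ (r₁ ≈ r₂) × ¬ (r₁ ≈ r₃) × ¬ (r₂ ≈ r₃) ×
      eval f r₁ ≈ 0# × eval f r₂ ≈ 0# × eval f r₃ ≈ 0#

  IsCube : Carrier → Set (c ⊔ ℓ)
  IsCube x = ∃ λ y → y ^ 3 ≈ x

  fpoly : Carrier → Carrier → Fin 3 → Poly
  fpoly a b zero = a ∷ 1# ∷ 0# ∷ 1# ∷ []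
  fpoly a b (suc zero) =
    (a ^ 2) * (b ^ 4) ∷ a * ((b + 1#) ^ 2) ∷ 1# ∷ a * (b ^ 2) ∷ []
  fpoly a b (suc (suc zero)) =
    (a ^ 2) * ((b + 1#) ^ 4) ∷ a * (b ^ 2) ∷ 1# ∷ a * ((b + 1#) ^ 2) ∷ []

{-# OPTIONS --safe #-}
module Submission where

-- In characteristic 2, s · t = 1 gives (s + t)³ + (s + t) = s³ + t³. Put C = ωⁱc and D = ω²ⁱ a(b + ω²)²;
-- then C · D = 1 and C + D is a, ab² or a(b + 1)². If y³ = C, the roots of X³ + X + (C + D) are
-- p y + p² y⁻¹ for the cube roots of unity p; conversely a root yields a cube root of C, and a cubic
-- without roots is irreducible. Since |L| = q², the Frobenius x ↦ x^q either fixes C and ω or maps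
-- them to D and ω², according to q mod 3, and in both cases it fixes the three roots. Finally f_i is,
-- up to nonzero factors, X³ + X + (C + D) composed with an affine map defined over 𝔽_q.

open import Defs
open import Level using (Level; _⊔_)
open import Data.Nat using (ℕ; zero; suc; _≤_)
import Data.Nat as ℕ
import Data.Nat.Properties as ℕ
open import Data.Fin as Fin using (Fin; toℕ)
import Data.Fin.Properties as Fin
open import Data.List using ([]; _∷_)
open import Data.Product using (_×_; _,_; proj₁; proj₂; ∃; Σ)
open import Data.Sum using (_⊎_; inj₁; inj₂)
open import Data.Empty using (⊥; ⊥-elim)
open import Relation.Nullary using (¬_; yes; no)
open import Relation.Binary.Definitions using (Decidable; tri<; tri≈; tri>)
open import Relation.Binary.PropositionalEquality as ≡ using (_≡_)
open import Algebra.Bundles using (CommutativeRing)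
open import Data.Nat.Tactic.RingSolver using (solve-∀)

2^k-mod-3 : ∀ k → (∃ λ s → 2 ℕ.^ k ≡ 3 ℕ.* s ℕ.+ 1) ⊎ (∃ λ s → 2 ℕ.^ k ≡ 3 ℕ.* s ℕ.+ 2)
2^k-mod-3 zero = inj₁ (0 , ≡.refl)
2^k-mod-3 (suc k) with 2^k-mod-3 k
... | inj₁ (s , 2^k≡3s+1) = inj₂ (2 ℕ.* s , ≡.trans (≡.cong (2 ℕ.*_) 2^k≡3s+1) (double-3s+1 s))
  where
  double-3s+1 : ∀ s → 2 ℕ.* (3 ℕ.* s ℕ.+ 1) ≡ 3 ℕ.* (2 ℕ.* s) ℕ.+ 2
  double-3s+1 = solve-∀
... | inj₂ (s , 2^k≡3s+2) = inj₁ (2 ℕ.* s ℕ.+ 1 , ≡.trans (≡.cong (2 ℕ.*_) 2^k≡3s+2) (double-3s+2 s))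
  where
  double-3s+2 : ∀ s → 2 ℕ.* (3 ℕ.* s ℕ.+ 2) ≡ 3 ℕ.* (2 ℕ.* s ℕ.+ 1) ℕ.+ 1
  double-3s+2 = solve-∀

[2^m]²-even : ∀ {m} → 1 ≤ m → ∃ λ k → 2 ℕ.^ m ℕ.* 2 ℕ.^ m ≡ 2 ℕ.* k
[2^m]²-even {suc m} _ = 2 ℕ.^ m ℕ.* 2 ℕ.^ suc m , ℕ.*-assoc 2 (2 ℕ.^ m) (2 ℕ.^ suc m)

module _ {c ℓ} (L : CommutativeRing c ℓ) where
  open CommutativeRing L renaming (_*_ to _·_) hiding (zero)
  open FF L renaming (_^_ to _↑_)
  open import Relation.Binary.Reasoning.Setoid setoid
  open import Algebra.Properties.Semiring.Exp semiring using (^-congˡ; ^-homo-*; ^-assocʳ)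
  open import Algebra.Properties.CommutativeSemiring.Exp commutativeSemiring using (^-distrib-*)
  open import Algebra.Properties.Ring ring
    using (x[y-z]≈xy-xz; x∙y⁻¹≈ε⇒x≈y; x≈y⇒x∙y⁻¹≈ε; -1*x≈-x; -‿involutive; -0#≈0#)

  1↑n≈1 : ∀ n → 1# ↑ n ≈ 1#
  1↑n≈1 zero = refl
  1↑n≈1 (suc n) = trans (*-identityˡ _) (1↑n≈1 n)

  ↑-comm : ∀ x n k → (x ↑ n) ↑ k ≈ (x ↑ k) ↑ n
  ↑-comm x n k = begin
    (x ↑ n) ↑ k     ≈⟨ ^-assocʳ x n k ⟩
    x ↑ (n ℕ.* k)   ≡⟨ ≡.cong (x ↑_) (ℕ.*-comm n k) ⟩
    x ↑ (k ℕ.* n)   ≈⟨ ^-assocʳ x k n ⟨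
    (x ↑ k) ↑ n     ∎

  ·∈F : ∀ k {x y} → InSub k x → InSub k y → InSub k (x · y)
  ·∈F k {x} {y} x∈F y∈F = trans (^-distrib-* x y (2 ℕ.^ k)) (*-cong x∈F y∈F)

  ↑∈F : ∀ k {x} n → InSub k x → InSub k (x ↑ n)
  ↑∈F k {x} n x∈F = trans (↑-comm x n (2 ℕ.^ k)) (^-congˡ n x∈F)

  eval-resp-≈ : ∀ p {x y} → x ≈ y → eval p x ≈ eval p y
  eval-resp-≈ [] x≈y = refl
  eval-resp-≈ (a ∷ p) x≈y = +-congˡ (*-cong x≈y (eval-resp-≈ p x≈y))

  eval-zero : ∀ p x → p ≃ [] → eval p x ≈ 0#
  eval-zero [] x p≃0 = refl
  eval-zero (a ∷ p) x p≃0 =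
    trans (+-cong (p≃0 0) (trans (*-congˡ (eval-zero p x (λ n → p≃0 (suc n)))) (zeroʳ x))) (+-identityˡ _)

  eval-resp-≃ : ∀ p r x → p ≃ r → eval p x ≈ eval r x
  eval-resp-≃ [] r x p≃r = sym (eval-zero r x (λ n → sym (p≃r n)))
  eval-resp-≃ (a ∷ p) [] x p≃r = eval-zero (a ∷ p) x p≃r
  eval-resp-≃ (a ∷ p) (b ∷ r) x p≃r = +-cong (p≃r 0) (*-congˡ (eval-resp-≃ p r x (λ n → p≃r (suc n))))

  module Field (F : IsField) where
    open IsField F public

    inv : ∀ x → x ≉ 0# → Carrier
    inv x x≉0 = proj₁ (inverse x x≉0)

    x·inv≈1 : ∀ x (x≉0 : x ≉ 0#) → x · inv x x≉0 ≈ 1#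
    x·inv≈1 x x≉0 = proj₂ (inverse x x≉0)

    1≉0 : 1# ≉ 0#
    1≉0 1≈0 = 0≉1 (sym 1≈0)

    x·y≈0⇒y≈0 : ∀ {x y} → x ≉ 0# → x · y ≈ 0# → y ≈ 0#
    x·y≈0⇒y≈0 {x} {y} x≉0 xy≈0 = begin
      y                       ≈⟨ *-identityˡ y ⟨
      1# · y                  ≈⟨ *-congʳ (trans (*-comm _ _) (x·inv≈1 x x≉0)) ⟨
      (inv x x≉0 · x) · y     ≈⟨ *-assoc _ _ _ ⟩
      inv x x≉0 · (x · y)     ≈⟨ *-congˡ xy≈0 ⟩
      inv x x≉0 · 0#          ≈⟨ zeroʳ _ ⟩
      0#                      ∎

    ·-nonzero : ∀ {x y} → x ≉ 0# → y ≉ 0# → x · y ≉ 0#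
    ·-nonzero x≉0 y≉0 xy≈0 = y≉0 (x·y≈0⇒y≈0 x≉0 xy≈0)

    ↑-nonzero : ∀ {x} n → x ≉ 0# → x ↑ n ≉ 0#
    ↑-nonzero zero x≉0 = 1≉0
    ↑-nonzero (suc n) x≉0 = ·-nonzero x≉0 (↑-nonzero n x≉0)

    x·y≈1⇒x≉0 : ∀ {x y} → x · y ≈ 1# → x ≉ 0#
    x·y≈1⇒x≉0 {x} {y} xy≈1 x≈0 = 0≉1 (begin
      0#     ≈⟨ zeroˡ y ⟨
      0# · y ≈⟨ *-congʳ x≈0 ⟨
      x · y  ≈⟨ xy≈1 ⟩
      1#     ∎)

    ·-cancelˡ : ∀ {x y z} → x ≉ 0# → x · y ≈ x · z → y ≈ z
    ·-cancelˡ {x} {y} {z} x≉0 xy≈xz =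
      x∙y⁻¹≈ε⇒x≈y y z (x·y≈0⇒y≈0 x≉0 (trans (x[y-z]≈xy-xz x y z) (x≈y⇒x∙y⁻¹≈ε xy≈xz)))

    inverse-unique : ∀ {x y z} → x · y ≈ 1# → x · z ≈ 1# → y ≈ z
    inverse-unique {x} {y} {z} xy≈1 xz≈1 = begin
      y             ≈⟨ *-identityʳ y ⟨
      y · 1#        ≈⟨ *-congˡ xz≈1 ⟨
      y · (x · z)   ≈⟨ *-assoc y x z ⟨
      (y · x) · z   ≈⟨ *-congʳ (trans (*-comm y x) xy≈1) ⟩
      1# · z        ≈⟨ *-identityˡ z ⟩
      z             ∎

  module Finite {n} (H : HasCard n) where
    open HasCard H

    index : Carrier → Fin n
    index x = proj₁ (enum-surj x)

    enum-index : ∀ x → enum (index x) ≈ x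
    enum-index x = proj₂ (enum-surj x)

    _≟_ : Decidable _≈_
    x ≟ y with index x Fin.≟ index y
    ... | yes i≡j = yes (trans (sym (enum-index x)) (trans (reflexive (≡.cong enum i≡j)) (enum-index y)))
    ... | no i≢j = no λ x≈y → i≢j (enum-inj _ _ (trans (enum-index x) (trans x≈y (sym (enum-index y)))))

  module Fermat (F : IsField) {n} (H : HasCard (suc n)) where
    open Field F
    open Finite H
    open HasCard H
    open import Algebra.Properties.CommutativeMonoid.Sum *-commutativeMonoid
      renaming (sum to ∏) using (sum-permute; sum-remove; sum-cong-≋; ∑-distrib-+; sum-replicate)
    open import Data.Vec.Functional using (Vector; replicate)
    open import Data.Fin.Permutation using (Permutation; permutation)

    dropZero : Carrier → Carrier
    dropZero x with x ≟ 0#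
    ... | yes _ = 1#
    ... | no _ = x

    dropZero-0 : ∀ {x} → x ≈ 0# → dropZero x ≈ 1#
    dropZero-0 {x} x≈0 with x ≟ 0#
    ... | yes _ = refl
    ... | no x≉0 = ⊥-elim (x≉0 x≈0)

    dropZero-≉0-id : ∀ {x} → x ≉ 0# → dropZero x ≈ x
    dropZero-≉0-id {x} x≉0 with x ≟ 0#
    ... | yes x≈0 = ⊥-elim (x≉0 x≈0)
    ... | no _ = refl

    dropZero-cong : ∀ {x y} → x ≈ y → dropZero x ≈ dropZero y
    dropZero-cong {x} {y} x≈y with x ≟ 0#
    ... | yes x≈0 = sym (dropZero-0 (trans (sym x≈y) x≈0))
    ... | no x≉0 = trans x≈y (sym (dropZero-≉0-id (λ y≈0 → x≉0 (trans x≈y y≈0))))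

    ∏-nonzero : ∀ {k} (f : Vector Carrier k) → (∀ i → f i ≉ 0#) → ∏ f ≉ 0#
    ∏-nonzero {zero} f _ = 1≉0
    ∏-nonzero {suc k} f f≉0 = ·-nonzero (f≉0 Fin.zero) (∏-nonzero (λ i → f (Fin.suc i)) (λ i → f≉0 (Fin.suc i)))

    ∏-scale : ∀ {k} x (f : Vector Carrier k) → ∏ (λ i → x · f i) ≈ x ↑ k · ∏ f
    ∏-scale {k} x f = trans (∑-distrib-+ (replicate k x) f) (*-congʳ (sum-replicate k))

    module _ (x : Carrier) (x≉0 : x ≉ 0#) where
      scale : Carrier → Fin (suc n) → Fin (suc n)
      scale y i = index (y · enum i)

      scale-inverse : ∀ {y z} → y · z ≈ 1# → ∀ i → scale y (scale z i) ≡ i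
      scale-inverse {y} {z} yz≈1 i = enum-inj _ _ (begin
        enum (scale y (scale z i)) ≈⟨ enum-index _ ⟩
        y · enum (scale z i)       ≈⟨ *-congˡ (enum-index _) ⟩
        y · (z · enum i)           ≈⟨ *-assoc y z _ ⟨
        (y · z) · enum i           ≈⟨ *-congʳ yz≈1 ⟩
        1# · enum i                ≈⟨ *-identityˡ _ ⟩
        enum i                     ∎)

      scaling : Permutation (suc n) (suc n)
      scaling = permutation (scale x) (scale (inv x x≉0))
        (scale-inverse (x·inv≈1 x x≉0)) (scale-inverse (trans (*-comm _ _) (x·inv≈1 x x≉0)))

      i₀ : Fin (suc n)
      i₀ = index 0#

      units : Vector Carrier n
      units j = enum (Fin.punchIn i₀ j)

      units-≉0 : ∀ j → units j ≉ 0#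
      units-≉0 j u≈0 = Fin.punchInᵢ≢i i₀ j (enum-inj _ _ (trans u≈0 (sym (enum-index 0#))))

      ∏-dropZero : ∀ y → y ≉ 0# → ∏ (λ i → dropZero (y · enum i)) ≈ y ↑ n · ∏ units
      ∏-dropZero y y≉0 = begin
        ∏ (λ i → dropZero (y · enum i))                  ≈⟨ sum-remove {i = i₀} (λ i → dropZero (y · enum i)) ⟩
        dropZero (y · enum i₀) · ∏ (λ j → dropZero (y · units j))
          ≈⟨ *-congʳ (dropZero-0 (trans (*-congˡ (enum-index 0#)) (zeroʳ y))) ⟩
        1# · ∏ (λ j → dropZero (y · units j))           ≈⟨ *-identityˡ _ ⟩
        ∏ (λ j → dropZero (y · units j))                 ≈⟨ sum-cong-≋ (λ j → dropZero-≉0-id (·-nonzero y≉0 (units-≉0 j))) ⟩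
        ∏ (λ j → y · units j)                            ≈⟨ ∏-scale y units ⟩
        y ↑ n · ∏ units                                  ∎

      -- multiplication by x permutes L, so ∏ over L of dropZero is both ∏ units and xⁿ · ∏ units
      x↑n≈1 : x ↑ n ≈ 1#
      x↑n≈1 = ·-cancelˡ (∏-nonzero units units-≉0) (begin
        ∏ units · x ↑ n                                   ≈⟨ *-comm _ _ ⟩
        x ↑ n · ∏ units                                   ≈⟨ ∏-dropZero x x≉0 ⟨
        ∏ (λ i → dropZero (x · enum i))                   ≈⟨ sum-cong-≋ {suc n} (λ i → dropZero-cong (enum-index (x · enum i))) ⟨
        ∏ (λ i → dropZero (enum (scale x i)))             ≈⟨ sum-permute (λ i → dropZero (enum i)) scaling ⟨
        ∏ (λ i → dropZero (enum i))                       ≈⟨ sum-cong-≋ {suc n} (λ i → dropZero-cong (sym (*-identityˡ (enum i)))) ⟩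
        ∏ (λ i → dropZero (1# · enum i))                  ≈⟨ ∏-dropZero 1# 1≉0 ⟩
        1# ↑ n · ∏ units                                  ≈⟨ *-congʳ (1↑n≈1 n) ⟩
        1# · ∏ units                                      ≈⟨ *-comm _ _ ⟩
        ∏ units · 1#                                      ∎)

    x↑[1+n]≈x : ∀ x → x ↑ suc n ≈ x
    x↑[1+n]≈x x with x ≟ 0#
    ... | yes x≈0 = trans (*-congʳ x≈0) (trans (zeroˡ _) (sym x≈0))
    ... | no x≉0 = trans (*-congˡ (x↑n≈1 x x≉0)) (*-identityʳ x)

  fermat : IsField → ∀ {n} → HasCard n → ∀ x → x ↑ n ≈ x
  fermat F {zero} H x with HasCard.enum-surj H x
  ... | () , _
  fermat F {suc n} H = Fermat.x↑[1+n]≈x F H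

  even-card⇒1+1≈0 : IsField → ∀ {k} → HasCard (2 ℕ.* k) → 1# + 1# ≈ 0#
  even-card⇒1+1≈0 F {k} H = begin
    1# + 1#                ≈⟨ +-congʳ 1≈-1 ⟩
    - 1# + 1#              ≈⟨ -‿inverseˡ 1# ⟩
    0#                     ∎
    where
    [-1]²≈1 : (- 1#) ↑ 2 ≈ 1#
    [-1]²≈1 = trans (*-congˡ (*-identityʳ _)) (trans (-1*x≈-x (- 1#)) (-‿involutive 1#))
    1≈-1 : 1# ≈ - 1#
    1≈-1 = begin
      1#                   ≈⟨ 1↑n≈1 k ⟨
      1# ↑ k               ≈⟨ ^-congˡ k [-1]²≈1 ⟨
      ((- 1#) ↑ 2) ↑ k     ≈⟨ ^-assocʳ (- 1#) 2 k ⟩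
      (- 1#) ↑ (2 ℕ.* k)   ≈⟨ fermat F H (- 1#) ⟩
      - 1#                 ∎

  module Char2 (1+1≈0 : 1# + 1# ≈ 0#) where
    open import Data.Bool using (Bool; _xor_; _∧_)
    open import Data.Bool public using (true; false)
    open import Data.Maybe using (Maybe; just; nothing)
    open import Algebra.Bundles.Raw using (RawRing)
    open import Algebra.Solver.Ring.AlmostCommutativeRing
      using (fromCommutativeRing; _-Raw-AlmostCommutative⟶_)
    open import Function using (id)

    𝔽₂ : RawRing _ _
    𝔽₂ = record
      { Carrier = Bool ; _≈_ = _≡_ ; _+_ = _xor_ ; _*_ = _∧_ ; -_ = id ; 0# = false ; 1# = true }

    ⟦_⟧𝔽₂ : Bool → Carrier
    ⟦ true ⟧𝔽₂ = 1#
    ⟦ false ⟧𝔽₂ = 0#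

    1≈-1 : 1# ≈ - 1#
    1≈-1 = begin
      1#                   ≈⟨ +-identityʳ 1# ⟨
      1# + 0#              ≈⟨ +-congˡ (-‿inverseʳ 1#) ⟨
      1# + (1# + - 1#)     ≈⟨ +-assoc 1# 1# (- 1#) ⟨
      (1# + 1#) + - 1#     ≈⟨ +-congʳ 1+1≈0 ⟩
      0# + - 1#            ≈⟨ +-identityˡ (- 1#) ⟩
      - 1#                 ∎

    𝔽₂-morphism : 𝔽₂ -Raw-AlmostCommutative⟶ fromCommutativeRing L
    𝔽₂-morphism = record
      { ⟦_⟧ = ⟦_⟧𝔽₂ ; +-homo = +-homo ; *-homo = *-homo ; -‿homo = -‿homo ; 0-homo = refl ; 1-homo = refl }
      where
      +-homo : ∀ x y → ⟦ x xor y ⟧𝔽₂ ≈ ⟦ x ⟧𝔽₂ + ⟦ y ⟧𝔽₂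
      +-homo true true = sym 1+1≈0
      +-homo true false = sym (+-identityʳ 1#)
      +-homo false y = sym (+-identityˡ _)
      *-homo : ∀ x y → ⟦ x ∧ y ⟧𝔽₂ ≈ ⟦ x ⟧𝔽₂ · ⟦ y ⟧𝔽₂
      *-homo true y = sym (*-identityˡ _)
      *-homo false y = sym (zeroˡ _)
      -‿homo : ∀ x → ⟦ x ⟧𝔽₂ ≈ - ⟦ x ⟧𝔽₂
      -‿homo true = 1≈-1
      -‿homo false = sym -0#≈0#

    𝔽₂-equal? : ∀ x y → Maybe (⟦ x ⟧𝔽₂ ≈ ⟦ y ⟧𝔽₂)
    𝔽₂-equal? true true = just refl
    𝔽₂-equal? false false = just refl
    𝔽₂-equal? _ _ = nothing

    -- ring normalisation with coefficients in 𝔽₂, so identities only valid in characteristic 2 are provable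
    open import Algebra.Solver.Ring 𝔽₂ (fromCommutativeRing L) 𝔽₂-morphism 𝔽₂-equal? public

    x+x≈0 : ∀ x → x + x ≈ 0#
    x+x≈0 x = begin
      x + x            ≈⟨ +-cong (*-identityˡ x) (*-identityˡ x) ⟨
      1# · x + 1# · x  ≈⟨ distribʳ x 1# 1# ⟨
      (1# + 1#) · x    ≈⟨ *-congʳ 1+1≈0 ⟩
      0# · x           ≈⟨ zeroˡ x ⟩
      0#               ∎

    x≈y⇒x+y≈0 : ∀ {x y} → x ≈ y → x + y ≈ 0#
    x≈y⇒x+y≈0 {x} {y} x≈y = trans (+-congʳ x≈y) (x+x≈0 y)

    x+y≈0⇒x≈y : ∀ {x y} → x + y ≈ 0# → x ≈ y
    x+y≈0⇒x≈y {x} {y} x+y≈0 = begin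
      x                ≈⟨ +-identityʳ x ⟨
      x + 0#           ≈⟨ +-congˡ (x+x≈0 y) ⟨
      x + (y + y)      ≈⟨ +-assoc x y y ⟨
      (x + y) + y      ≈⟨ +-congʳ x+y≈0 ⟩
      0# + y           ≈⟨ +-identityˡ y ⟩
      y                ∎

    ≈-by-multiple : ∀ {x y} q r → r ≈ 0# → x + y ≈ q · r → x ≈ y
    ≈-by-multiple q r r≈0 x+y≈qr = x+y≈0⇒x≈y (trans x+y≈qr (trans (*-congˡ r≈0) (zeroʳ q)))

    ≈-by-combination : ∀ {x y} q₁ r₁ q₂ r₂ → r₁ ≈ 0# → r₂ ≈ 0# → x + y ≈ q₁ · r₁ + q₂ · r₂ → x ≈ y
    ≈-by-combination q₁ r₁ q₂ r₂ r₁≈0 r₂≈0 x+y≈ = x+y≈0⇒x≈y (trans x+y≈ (trans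
      (+-cong (trans (*-congˡ r₁≈0) (zeroʳ q₁)) (trans (*-congˡ r₂≈0) (zeroʳ q₂))) (+-identityʳ 0#)))

    [x+y]²≈x²+y² : ∀ x y → (x + y) ↑ 2 ≈ x ↑ 2 + y ↑ 2
    [x+y]²≈x²+y² = solve 2 (λ x y → (x :+ y) :^ 2 := x :^ 2 :+ y :^ 2) refl

    [x+y]↑2^k : ∀ k x y → (x + y) ↑ (2 ℕ.^ k) ≈ x ↑ (2 ℕ.^ k) + y ↑ (2 ℕ.^ k)
    [x+y]↑2^k zero x y = trans (*-identityʳ (x + y)) (+-cong (sym (*-identityʳ x)) (sym (*-identityʳ y)))
    [x+y]↑2^k (suc k) x y = begin
      (x + y) ↑ (2 ℕ.* n)          ≈⟨ ^-assocʳ (x + y) 2 n ⟨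
      ((x + y) ↑ 2) ↑ n            ≈⟨ ^-congˡ n ([x+y]²≈x²+y² x y) ⟩
      (x ↑ 2 + y ↑ 2) ↑ n          ≈⟨ [x+y]↑2^k k (x ↑ 2) (y ↑ 2) ⟩
      (x ↑ 2) ↑ n + (y ↑ 2) ↑ n    ≈⟨ +-cong (^-assocʳ x 2 n) (^-assocʳ y 2 n) ⟩
      x ↑ (2 ℕ.* n) + y ↑ (2 ℕ.* n) ∎
      where
      n : ℕ
      n = 2 ℕ.^ k

    +∈F : ∀ k {x y} → InSub k x → InSub k y → InSub k (x + y)
    +∈F k {x} {y} x∈F y∈F = trans ([x+y]↑2^k k x y) (+-cong x∈F y∈F)

  module Subfield (F : IsField) where
    open Field F

    0∈F : ∀ k → InSub k 0#
    0∈F k = go (2 ℕ.^ k) {{ℕ.m^n≢0 2 k}}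
      where
      go : ∀ n → .{{ℕ.NonZero n}} → 0# ↑ n ≈ 0#
      go (suc n) = zeroˡ _

    1∈F : ∀ k → InSub k 1#
    1∈F k = 1↑n≈1 (2 ℕ.^ k)

    inv∈F : ∀ k {x} (x≉0 : x ≉ 0#) → InSub k x → InSub k (inv x x≉0)
    inv∈F k {x} x≉0 x∈F = inverse-unique (trans (*-congʳ (sym x∈F)) (trans (sym (^-distrib-* x _ n))
                              (trans (^-congˡ n (x·inv≈1 x x≉0)) (1↑n≈1 n)))) (x·inv≈1 x x≉0)
      where
      n : ℕ
      n = 2 ℕ.^ k

  module Polynomials (F : IsField) (_≟_ : Decidable _≈_) where
    open Field F
    open Subfield F
    open import Data.List using (map)
    open import Data.List.Relation.Unary.All using ([]; _∷_)

    HasDegree : Poly → ℕ → Carrier → Set ℓ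
    HasDegree p d t = coeff p d ≈ t × (∀ n → d ℕ.< n → coeff p n ≈ 0#)

    cubic-degree : ∀ a₀ a₁ a₂ a₃ → HasDegree (a₀ ∷ a₁ ∷ a₂ ∷ a₃ ∷ []) 3 a₃
    cubic-degree a₀ a₁ a₂ a₃ = refl , λ where
      (suc (suc (suc (suc n)))) _ → refl
      (suc (suc (suc zero))) (ℕ.s≤s (ℕ.s≤s (ℕ.s≤s ())))
      (suc (suc zero)) (ℕ.s≤s (ℕ.s≤s ()))
      (suc zero) (ℕ.s≤s ())

    coeff-⊕ : ∀ p r n → coeff (p ⊕ r) n ≈ coeff p n + coeff r n
    coeff-⊕ [] r n = sym (+-identityˡ _)
    coeff-⊕ (a ∷ p) [] n = sym (+-identityʳ _)
    coeff-⊕ (a ∷ p) (b ∷ r) zero = refl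
    coeff-⊕ (a ∷ p) (b ∷ r) (suc n) = coeff-⊕ p r n

    coeff-map : ∀ a r n → coeff (map (a ·_) r) n ≈ a · coeff r n
    coeff-map a [] n = sym (zeroʳ a)
    coeff-map a (b ∷ r) zero = refl
    coeff-map a (b ∷ r) (suc n) = coeff-map a r n

    coeff-∷⊛ : ∀ a p r n → coeff ((a ∷ p) ⊛ r) n ≈ a · coeff r n + coeff (0# ∷ (p ⊛ r)) n
    coeff-∷⊛ a p r n = trans (coeff-⊕ (map (a ·_) r) (0# ∷ (p ⊛ r)) n) (+-congʳ (coeff-map a r n))

    ⊛-zeroˡ : ∀ p r → p ≃ [] → (p ⊛ r) ≃ []
    ⊛-zeroˡ [] r p≃0 n = refl
    ⊛-zeroˡ (a ∷ p) r p≃0 n =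
      trans (coeff-∷⊛ a p r n) (trans (+-cong (trans (*-congʳ (p≃0 0)) (zeroˡ _)) (tail n)) (+-identityˡ _))
      where
      tail : ∀ n → coeff (0# ∷ (p ⊛ r)) n ≈ 0#
      tail zero = refl
      tail (suc n) = ⊛-zeroˡ p r (λ k → p≃0 (suc k)) n

    ⊛-zeroʳ : ∀ p r → r ≃ [] → (p ⊛ r) ≃ []
    ⊛-zeroʳ [] r r≃0 n = refl
    ⊛-zeroʳ (a ∷ p) r r≃0 n =
      trans (coeff-∷⊛ a p r n) (trans (+-cong (trans (*-congˡ (r≃0 n)) (zeroʳ _)) (tail n)) (+-identityˡ _))
      where
      tail : ∀ n → coeff (0# ∷ (p ⊛ r)) n ≈ 0#
      tail zero = refl
      tail (suc n) = ⊛-zeroʳ p r r≃0 n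

    degree-⊛ : ∀ p r {d e s t} → HasDegree p d s → HasDegree r e t → HasDegree (p ⊛ r) (d ℕ.+ e) (s · t)
    degree-⊛ [] r (0≈s , _) _ = trans (sym (zeroˡ _)) (*-congʳ 0≈s) , λ _ _ → refl
    degree-⊛ (a ∷ p) r {zero} {e} (a≈s , p≃0) (re≈t , r-top) =
      trans (coeff-∷⊛ a p r e) (trans (+-congˡ (tail e)) (trans (+-identityʳ _) (*-cong a≈s re≈t))) ,
      λ n e<n → trans (coeff-∷⊛ a p r n) (trans (+-cong (trans (*-congˡ (r-top n e<n)) (zeroʳ a)) (tail n)) (+-identityˡ _))
      where
      tail : ∀ n → coeff (0# ∷ (p ⊛ r)) n ≈ 0#
      tail zero = refl
      tail (suc n) = ⊛-zeroˡ p r (λ k → p≃0 (suc k) (ℕ.s≤s ℕ.z≤n)) n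
    degree-⊛ (a ∷ p) r {suc d} {e} {s} {t} (pd≈s , p-top) (re≈t , r-top) = leading , vanishing
      where
      ih : HasDegree (p ⊛ r) (d ℕ.+ e) (s · t)
      ih = degree-⊛ p r (pd≈s , λ n d<n → p-top (suc n) (ℕ.s≤s d<n)) (re≈t , r-top)
      a·r[_]≈0 : ∀ {n} → e ℕ.< n → a · coeff r n ≈ 0#
      a·r[_]≈0 e<n = trans (*-congˡ (r-top _ e<n)) (zeroʳ a)
      leading : coeff ((a ∷ p) ⊛ r) (suc d ℕ.+ e) ≈ s · t
      leading = trans (coeff-∷⊛ a p r (suc d ℕ.+ e))
        (trans (+-congʳ (a·r[_]≈0 (ℕ.s≤s (ℕ.m≤n+m e d)))) (trans (+-identityˡ _) (proj₁ ih)))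
      vanishing : ∀ n → suc d ℕ.+ e ℕ.< n → coeff ((a ∷ p) ⊛ r) n ≈ 0#
      vanishing (suc n) d+e<n = trans (coeff-∷⊛ a p r (suc n))
        (trans (+-cong (a·r[_]≈0 (ℕ.<-trans (ℕ.s≤s (ℕ.m≤n+m e d)) d+e<n)) (proj₂ ih n (ℕ.≤-pred d+e<n))) (+-identityˡ _))

    zero-or-degree : ∀ p → p ≃ [] ⊎ Σ ℕ λ d → Σ Carrier λ t → t ≉ 0# × HasDegree p d t
    zero-or-degree [] = inj₁ (λ _ → refl)
    zero-or-degree (a ∷ p) with zero-or-degree p
    ... | inj₂ (d , t , t≉0 , pd≈t , p-top) =
      inj₂ (suc d , t , t≉0 , pd≈t , λ { zero () ; (suc n) d<n → p-top n (ℕ.≤-pred d<n) })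
    ... | inj₁ p≃0 with a ≟ 0#
    ...   | yes a≈0 = inj₁ λ { zero → a≈0 ; (suc n) → p≃0 n }
    ...   | no a≉0 = inj₂ (zero , a , a≉0 , refl , λ { zero () ; (suc n) _ → p≃0 n })

    eval-⊕ : ∀ p r x → eval (p ⊕ r) x ≈ eval p x + eval r x
    eval-⊕ [] r x = sym (+-identityˡ _)
    eval-⊕ (a ∷ p) [] x = sym (+-identityʳ _)
    eval-⊕ (a ∷ p) (b ∷ r) x = begin
      (a + b) + x · eval (p ⊕ r) x              ≈⟨ +-congˡ (trans (*-congˡ (eval-⊕ p r x)) (distribˡ _ _ _)) ⟩
      (a + b) + (x · eval p x + x · eval r x)   ≈⟨ +-assoc a b _ ⟩
      a + (b + (x · eval p x + x · eval r x))   ≈⟨ +-congˡ (trans (sym (+-assoc _ _ _)) (trans (+-congʳ (+-comm _ _)) (+-assoc _ _ _))) ⟩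
      a + (x · eval p x + (b + x · eval r x))   ≈⟨ +-assoc a _ _ ⟨
      (a + x · eval p x) + (b + x · eval r x)   ∎

    eval-map : ∀ a r x → eval (map (a ·_) r) x ≈ a · eval r x
    eval-map a [] x = sym (zeroʳ a)
    eval-map a (b ∷ r) x = begin
      a · b + x · eval (map (a ·_) r) x   ≈⟨ +-congˡ (*-congˡ (eval-map a r x)) ⟩
      a · b + x · (a · eval r x)          ≈⟨ +-congˡ (trans (sym (*-assoc _ _ _)) (trans (*-congʳ (*-comm x a)) (*-assoc _ _ _))) ⟩
      a · b + a · (x · eval r x)          ≈⟨ distribˡ a b _ ⟨
      a · (b + x · eval r x)              ∎

    eval-⊛ : ∀ p r x → eval (p ⊛ r) x ≈ eval p x · eval r x
    eval-⊛ [] r x = sym (zeroˡ _)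
    eval-⊛ (a ∷ p) r x = begin
      eval (map (a ·_) r ⊕ (0# ∷ (p ⊛ r))) x            ≈⟨ eval-⊕ (map (a ·_) r) _ x ⟩
      eval (map (a ·_) r) x + (0# + x · eval (p ⊛ r) x) ≈⟨ +-cong (eval-map a r x) (trans (+-identityˡ _) (*-congˡ (eval-⊛ p r x))) ⟩
      a · eval r x + x · (eval p x · eval r x)          ≈⟨ +-congˡ (*-assoc _ _ _) ⟨
      a · eval r x + (x · eval p x) · eval r x          ≈⟨ distribʳ _ _ _ ⟨
      (a + x · eval p x) · eval r x                     ∎

    coeff-⊛-constant : ∀ p u n → coeff (p ⊛ (u ∷ [])) n ≈ coeff p n · u
    coeff-⊛-constant [] u n = sym (zeroˡ u)
    coeff-⊛-constant (a ∷ p) u zero = trans (coeff-∷⊛ a p (u ∷ []) zero) (+-identityʳ _)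
    coeff-⊛-constant (a ∷ p) u (suc n) =
      trans (coeff-∷⊛ a p (u ∷ []) (suc n)) (trans (+-congʳ (zeroʳ a)) (trans (+-identityˡ _) (coeff-⊛-constant p u n)))

    coeff∈F : ∀ k p n → PolyOver k p → InSub k (coeff p n)
    coeff∈F k [] n _ = 0∈F k
    coeff∈F k (a ∷ p) zero (a∈F ∷ _) = a∈F
    coeff∈F k (a ∷ p) (suc n) (_ ∷ p∈F) = coeff∈F k p n p∈F

    degree-0⇒unit : ∀ k g {s} → s ≉ 0# → HasDegree g 0 s → PolyOver k g → IsUnit k g
    degree-0⇒unit k g {s} s≉0 (g₀≈s , g-top) g∈F =
      (inv s s≉0 ∷ []) , (inv∈F k s≉0 (trans (^-congˡ (2 ℕ.^ k) (sym g₀≈s)) (trans (coeff∈F k g 0 g∈F) g₀≈s)) ∷ []) , λ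
        { zero → trans (coeff-⊛-constant g _ 0) (trans (*-congʳ g₀≈s) (x·inv≈1 s s≉0))
        ; (suc n) → trans (coeff-⊛-constant g _ (suc n)) (trans (*-congʳ (g-top (suc n) (ℕ.s≤s ℕ.z≤n))) (zeroˡ _)) }

    degree-1⇒root : ∀ g {s} → s ≉ 0# → HasDegree g 1 s → ∃ λ x → eval g x ≈ 0#
    degree-1⇒root g {s} s≉0 (g₁≈s , g-top) = x , (begin
      eval g x                        ≈⟨ eval-resp-≃ g (g₀ ∷ s ∷ []) x linear ⟩
      g₀ + x · (s + x · 0#)           ≈⟨ +-congˡ (*-congˡ (trans (+-congˡ (zeroʳ x)) (+-identityʳ s))) ⟩
      g₀ + (- g₀ · inv s s≉0) · s     ≈⟨ +-congˡ (*-assoc _ _ _) ⟩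
      g₀ + - g₀ · (inv s s≉0 · s)     ≈⟨ +-congˡ (*-congˡ (trans (*-comm _ _) (x·inv≈1 s s≉0))) ⟩
      g₀ + - g₀ · 1#                  ≈⟨ +-congˡ (*-identityʳ _) ⟩
      g₀ + - g₀                       ≈⟨ -‿inverseʳ g₀ ⟩
      0#                              ∎)
      where
      g₀ x : Carrier
      g₀ = coeff g 0
      x = - g₀ · inv s s≉0
      linear : g ≃ (g₀ ∷ s ∷ [])
      linear zero = refl
      linear (suc zero) = g₁≈s
      linear (suc (suc n)) = g-top _ (ℕ.s≤s (ℕ.s≤s ℕ.z≤n))

    -- a proper factorisation of a cubic has a linear factor, which has a root in L
    cubic-irreducible : ∀ k f {t} → HasDegree f 3 t → t ≉ 0# → (∀ x → eval f x ≉ 0#) → Irreducible k f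
    cubic-irreducible k f {t} (f₃≈t , f-top) t≉0 no-root = f≄0 , not-unit , factorisation
      where
      f≄0 : ¬ (f ≃ [])
      f≄0 f≃0 = t≉0 (trans (sym f₃≈t) (f≃0 3))
      not-unit : ¬ IsUnit k f
      not-unit (r , _ , fr≃1) with zero-or-degree r
      ... | inj₁ r≃0 = 0≉1 (trans (sym (⊛-zeroʳ f r r≃0 0)) (fr≃1 0))
      ... | inj₂ (d , t′ , t′≉0 , r-deg) =
        ·-nonzero t≉0 t′≉0 (trans (sym (proj₁ (degree-⊛ f r (f₃≈t , f-top) r-deg))) (fr≃1 (3 ℕ.+ d)))
      factorisation : ∀ g h → PolyOver k g → PolyOver k h → f ≃ (g ⊛ h) → IsUnit k g ⊎ IsUnit k h
      factorisation g h g∈F h∈F f≃gh with zero-or-degree g | zero-or-degree h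
      ... | inj₁ g≃0 | _ = ⊥-elim (f≄0 (λ n → trans (f≃gh n) (⊛-zeroˡ g h g≃0 n)))
      ... | inj₂ _ | inj₁ h≃0 = ⊥-elim (f≄0 (λ n → trans (f≃gh n) (⊛-zeroʳ g h h≃0 n)))
      ... | inj₂ (d , s , s≉0 , g-deg) | inj₂ (d′ , s′ , s′≉0 , h-deg) with ℕ.<-cmp (d ℕ.+ d′) 3
      ...   | tri< d+d′<3 _ _ = ⊥-elim (t≉0 (trans (sym f₃≈t) (trans (f≃gh 3) (proj₂ (degree-⊛ g h g-deg h-deg) 3 d+d′<3))))
      ...   | tri> _ _ d+d′>3 = ⊥-elim (·-nonzero s≉0 s′≉0
                (trans (sym (proj₁ (degree-⊛ g h g-deg h-deg))) (trans (sym (f≃gh (d ℕ.+ d′))) (f-top _ d+d′>3))))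
      ...   | tri≈ _ d+d′≡3 _ = split d d′ d+d′≡3 g-deg h-deg
        where
        root-of-factor : ∀ x → eval g x · eval h x ≈ 0# → ⊥
        root-of-factor x gh≈0 = no-root x (trans (eval-resp-≃ f (g ⊛ h) x f≃gh) (trans (eval-⊛ g h x) gh≈0))
        split : ∀ d d′ → d ℕ.+ d′ ≡ 3 → HasDegree g d s → HasDegree h d′ s′ → IsUnit k g ⊎ IsUnit k h
        split 0 3 ≡.refl g-deg _ = inj₁ (degree-0⇒unit k g s≉0 g-deg g∈F)
        split 3 0 ≡.refl _ h-deg = inj₂ (degree-0⇒unit k h s′≉0 h-deg h∈F)
        split 1 2 ≡.refl g-deg _ with degree-1⇒root g s≉0 g-deg
        ... | x , gx≈0 = ⊥-elim (root-of-factor x (trans (*-congʳ gx≈0) (zeroˡ _)))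
        split 2 1 ≡.refl _ h-deg with degree-1⇒root h s′≉0 h-deg
        ... | x , hx≈0 = ⊥-elim (root-of-factor x (trans (*-congˡ hx≈0) (zeroʳ _)))

  module Char2Field (F : IsField) (_≟_ : Decidable _≈_) (1+1≈0 : 1# + 1# ≈ 0#) where
    open Field F
    open Char2 1+1≈0

    x²≈0⇒x≈0 : ∀ {x} → x ↑ 2 ≈ 0# → x ≈ 0#
    x²≈0⇒x≈0 {x} x²≈0 with x ≟ 0#
    ... | yes x≈0 = x≈0
    ... | no x≉0 = ⊥-elim (↑-nonzero 2 x≉0 x²≈0)

    x²≈1⇒x≈1 : ∀ {x} → x ↑ 2 ≈ 1# → x ≈ 1#
    x²≈1⇒x≈1 {x} x²≈1 = x+y≈0⇒x≈y (x²≈0⇒x≈0 (begin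
      (x + 1#) ↑ 2     ≈⟨ solve 1 (λ x → (x :+ con true) :^ 2 := x :^ 2 :+ con true) refl x ⟩
      x ↑ 2 + 1#       ≈⟨ x≈y⇒x+y≈0 x²≈1 ⟩
      0#               ∎))

    cubic : Carrier → Poly
    cubic A = A ∷ 1# ∷ 0# ∷ 1# ∷ []

    eval-cubic : ∀ A z → eval (cubic A) z ≈ z ↑ 3 + z + A
    eval-cubic = solve 2 (λ A z → A :+ z :* (con true :+ z :* (con false :+ z :* (con true :+ z :* con false)))
                                 := z :^ 3 :+ z :+ A) refl

    root-of-cubic : ∀ {A z} → z ↑ 3 + z ≈ A → eval (cubic A) z ≈ 0#
    root-of-cubic {A} {z} z³+z≈A = trans (eval-cubic A z) (x≈y⇒x+y≈0 z³+z≈A)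

    root-of-cubic⁻¹ : ∀ {A z} → eval (cubic A) z ≈ 0# → z ↑ 3 + z ≈ A
    root-of-cubic⁻¹ {A} {z} root = x+y≈0⇒x≈y (trans (sym (eval-cubic A z)) root)

    [s+t]³+[s+t]≈s³+t³ : ∀ {s t} → s · t ≈ 1# → (s + t) ↑ 3 + (s + t) ≈ s ↑ 3 + t ↑ 3
    [s+t]³+[s+t]≈s³+t³ {s} {t} st≈1 = ≈-by-multiple (s + t) (s · t + 1#) (x≈y⇒x+y≈0 st≈1)
      (solve 2 (λ s t → ((s :+ t) :^ 3 :+ (s :+ t)) :+ (s :^ 3 :+ t :^ 3) := (s :+ t) :* (s :* t :+ con true)) refl s t)

    -- z = y + y⁻¹ with y³ = C, and y is recovered from z as (C + z)/(z + 1)²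
    root⇒cube : ∀ {C D z} → C · D ≈ 1# → C + D ≉ 0# → z ↑ 3 + z ≈ C + D → IsCube C
    root⇒cube {C} {D} {z} CD≈1 C+D≉0 z³+z≈C+D = (C + z) · w ↑ 2 , (begin
      ((C + z) · w ↑ 2) ↑ 3     ≈⟨ solve 2 (λ x w → (x :* w :^ 2) :^ 3 := x :^ 3 :* w :^ 6) refl (C + z) w ⟩
      (C + z) ↑ 3 · w ↑ 6       ≈⟨ *-congʳ [C+z]³≈C[z+1]⁶ ⟩
      C · (z + 1#) ↑ 6 · w ↑ 6  ≈⟨ solve 3 (λ C x w → C :* x :^ 6 :* w :^ 6 := C :* (x :* w) :^ 6) refl C (z + 1#) w ⟩
      C · ((z + 1#) · w) ↑ 6    ≈⟨ *-congˡ (trans (^-congˡ 6 (x·inv≈1 _ z+1≉0)) (1↑n≈1 6)) ⟩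
      C · 1#                    ≈⟨ *-identityʳ C ⟩
      C                         ∎)
      where
      z+1≉0 : z + 1# ≉ 0#
      z+1≉0 z+1≈0 = C+D≉0 (begin
        C + D          ≈⟨ z³+z≈C+D ⟨
        z ↑ 3 + z      ≈⟨ +-cong (^-congˡ 3 z≈1) z≈1 ⟩
        1# ↑ 3 + 1#    ≈⟨ solve 0 (con true :^ 3 :+ con true := con false) refl ⟩
        0#             ∎)
        where
        z≈1 : z ≈ 1#
        z≈1 = x+y≈0⇒x≈y z+1≈0
      w : Carrier
      w = inv (z + 1#) z+1≉0
      [C+z]³≈C[z+1]⁶ : (C + z) ↑ 3 ≈ C · (z + 1#) ↑ 6
      [C+z]³≈C[z+1]⁶ = ≈-by-combination ((C + z ↑ 3) · C) (z ↑ 3 + z + (C + D)) (C + z ↑ 3) (C · D + 1#)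
        (x≈y⇒x+y≈0 z³+z≈C+D) (x≈y⇒x+y≈0 CD≈1)
        (solve 3 (λ C D z → (C :+ z) :^ 3 :+ C :* (z :+ con true) :^ 6
                         := (C :+ z :^ 3) :* C :* (z :^ 3 :+ z :+ (C :+ D)) :+ (C :+ z :^ 3) :* (C :* D :+ con true))
               refl C D z)

    module CubeRoot {y u : Carrier} (yu≈1 : y · u ≈ 1#) where

      ρ : Carrier → Carrier
      ρ p = p · y + p ↑ 2 · u

      ρ-root : ∀ {p} → p ↑ 3 ≈ 1# → ρ p ↑ 3 + ρ p ≈ y ↑ 3 + u ↑ 3
      ρ-root {p} p³≈1 = begin
        ρ p ↑ 3 + ρ p                     ≈⟨ [s+t]³+[s+t]≈s³+t³ (begin
          (p · y) · (p ↑ 2 · u)               ≈⟨ solve 3 (λ p y u → (p :* y) :* (p :^ 2 :* u) := p :^ 3 :* (y :* u)) refl p y u ⟩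
          p ↑ 3 · (y · u)                     ≈⟨ *-cong p³≈1 yu≈1 ⟩
          1# · 1#                             ≈⟨ *-identityʳ 1# ⟩
          1#                                  ∎) ⟩
        (p · y) ↑ 3 + (p ↑ 2 · u) ↑ 3     ≈⟨ solve 3 (λ p y u → (p :* y) :^ 3 :+ (p :^ 2 :* u) :^ 3
                                                          := p :^ 3 :* y :^ 3 :+ (p :^ 3) :^ 2 :* u :^ 3) refl p y u ⟩
        p ↑ 3 · y ↑ 3 + (p ↑ 3) ↑ 2 · u ↑ 3 ≈⟨ +-cong (*-congʳ p³≈1) (*-congʳ (trans (^-congˡ 2 p³≈1) (1↑n≈1 2))) ⟩
        1# · y ↑ 3 + 1# · u ↑ 3           ≈⟨ +-cong (*-identityˡ _) (*-identityˡ _) ⟩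
        y ↑ 3 + u ↑ 3                     ∎

      ρ-+ : ∀ p p′ → ρ (p + p′) ≈ ρ p + ρ p′
      ρ-+ p p′ = solve 4 (λ p p′ y u → (p :+ p′) :* y :+ (p :+ p′) :^ 2 :* u
                                  := (p :* y :+ p :^ 2 :* u) :+ (p′ :* y :+ p′ :^ 2 :* u)) refl p p′ y u

      -- ρ s ≈ 0 forces y² ≈ s, hence y⁶ ≈ 1 and y³ ≈ u³
      ρ≉0 : ∀ {s} → s ↑ 3 ≈ 1# → y ↑ 3 + u ↑ 3 ≉ 0# → ρ s ≉ 0#
      ρ≉0 {s} s³≈1 y³+u³≉0 ρs≈0 = y³+u³≉0 (begin
        y ↑ 3 + u ↑ 3               ≈⟨ ≈-by-multiple (y ↑ 3 · (y ↑ 2 · u ↑ 2 + y · u + 1#)) (y · u + 1#) (x≈y⇒x+y≈0 yu≈1)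
                                         (solve 2 (λ y u → (y :^ 3 :+ u :^ 3) :+ u :^ 3 :* ((y :^ 2) :^ 3 :+ con true)
                                                       := y :^ 3 :* (y :^ 2 :* u :^ 2 :+ y :* u :+ con true) :* (y :* u :+ con true)) refl y u) ⟩
        u ↑ 3 · ((y ↑ 2) ↑ 3 + 1#)  ≈⟨ *-congˡ (x≈y⇒x+y≈0 (trans (^-congˡ 3 y²≈s) s³≈1)) ⟩
        u ↑ 3 · 0#                  ≈⟨ zeroʳ _ ⟩
        0#                          ∎)
        where
        s≉0 : s ≉ 0#
        s≉0 = x·y≈1⇒x≉0 (trans (solve 1 (λ s → s :* s :^ 2 := s :^ 3) refl s) s³≈1)
        y²≈s : y ↑ 2 ≈ s
        y²≈s = ·-cancelˡ s≉0 (begin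
          s · y ↑ 2          ≈⟨ solve 2 (λ s y → s :* y :^ 2 := (s :* y) :* y) refl s y ⟩
          (s · y) · y        ≈⟨ *-congʳ (x+y≈0⇒x≈y ρs≈0) ⟩
          (s ↑ 2 · u) · y    ≈⟨ solve 3 (λ s y u → (s :^ 2 :* u) :* y := (s :* s) :* (y :* u)) refl s y u ⟩
          (s · s) · (y · u)  ≈⟨ *-congˡ yu≈1 ⟩
          (s · s) · 1#       ≈⟨ *-identityʳ _ ⟩
          s · s              ∎)

      ρ-injective : ∀ {p p′} → (p + p′) ↑ 3 ≈ 1# → y ↑ 3 + u ↑ 3 ≉ 0# → ρ p ≉ ρ p′
      ρ-injective {p} {p′} [p+p′]³≈1 y³+u³≉0 ρp≈ρp′ =
        ρ≉0 [p+p′]³≈1 y³+u³≉0 (trans (ρ-+ p p′) (x≈y⇒x+y≈0 ρp≈ρp′))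

    cubic-no-root : ∀ {C D A} → C · D ≈ 1# → C + D ≈ A → A ≉ 0# → ¬ IsCube C → ∀ z → eval (cubic A) z ≉ 0#
    cubic-no-root CD≈1 C+D≈A A≉0 ¬cube z root =
      ¬cube (root⇒cube CD≈1 (λ C+D≈0 → A≉0 (trans (sym C+D≈A) C+D≈0)) (trans (root-of-cubic⁻¹ root) (sym C+D≈A)))

    record AffinelyRelated (k : ℕ) (f g : Poly) : Set (c ⊔ ℓ) where
      field
        κ μ α β : Carrier
        κ≉0 : κ ≉ 0#
        μ≉0 : μ ≉ 0#
        α≉0 : α ≉ 0#
        α∈F : InSub k α
        β∈F : InSub k β
        eval-relation : ∀ x → κ · eval f x ≈ μ · eval g (α · x + β)

    module _ {k f g} (rel : AffinelyRelated k f g) where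
      open AffinelyRelated rel
      open Subfield F

      preimage : Carrier → Carrier
      preimage z = (z + β) · inv α α≉0

      image-preimage : ∀ z → α · preimage z + β ≈ z
      image-preimage z = begin
        α · ((z + β) · inv α α≉0) + β  ≈⟨ +-congʳ (solve 3 (λ a x i → a :* (x :* i) := x :* (a :* i)) refl α (z + β) _) ⟩
        (z + β) · (α · inv α α≉0) + β  ≈⟨ +-congʳ (trans (*-congˡ (x·inv≈1 α α≉0)) (*-identityʳ _)) ⟩
        (z + β) + β                    ≈⟨ solve 2 (λ z b → (z :+ b) :+ b := z) refl z β ⟩
        z                              ∎

      preimage∈F : ∀ {z} → InSub k z → InSub k (preimage z)
      preimage∈F z∈F = ·∈F k (+∈F k z∈F β∈F) (inv∈F k α≉0 α∈F)

      preimage-root : ∀ {z} → eval g z ≈ 0# → eval f (preimage z) ≈ 0#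
      preimage-root {z} gz≈0 = x·y≈0⇒y≈0 κ≉0 (begin
        κ · eval f (preimage z)                   ≈⟨ eval-relation (preimage z) ⟩
        μ · eval g (α · preimage z + β)           ≈⟨ *-congˡ (eval-resp-≈ g (image-preimage z)) ⟩
        μ · eval g z                              ≈⟨ *-congˡ gz≈0 ⟩
        μ · 0#                                    ≈⟨ zeroʳ μ ⟩
        0#                                        ∎)

      ThreeDistinctRoots-transfer : ThreeDistinctRoots k g → ThreeDistinctRoots k f
      ThreeDistinctRoots-transfer (z₁ , z₂ , z₃ , z₁∈F , z₂∈F , z₃∈F , z₁≉z₂ , z₁≉z₃ , z₂≉z₃ , r₁ , r₂ , r₃) =
        preimage z₁ , preimage z₂ , preimage z₃ ,
        preimage∈F z₁∈F , preimage∈F z₂∈F , preimage∈F z₃∈F ,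
        preimage-injective z₁≉z₂ , preimage-injective z₁≉z₃ , preimage-injective z₂≉z₃ ,
        preimage-root r₁ , preimage-root r₂ , preimage-root r₃
        where
        preimage-injective : ∀ {z z′} → z ≉ z′ → preimage z ≉ preimage z′
        preimage-injective z≉z′ x≈x′ =
          z≉z′ (trans (sym (image-preimage _)) (trans (+-congʳ (*-congˡ x≈x′)) (image-preimage _)))

      AffinelyRelated-resp-≃ : ∀ {f′} → f ≃ f′ → AffinelyRelated k f′ g
      AffinelyRelated-resp-≃ {f′} f≃f′ = record
        { κ≉0 = κ≉0 ; μ≉0 = μ≉0 ; α≉0 = α≉0 ; α∈F = α∈F ; β∈F = β∈F
        ; eval-relation = λ x → trans (*-congˡ (eval-resp-≃ f′ f x (λ n → sym (f≃f′ n)))) (eval-relation x) }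

      no-root-transfer : (∀ z → eval g z ≉ 0#) → ∀ x → eval f x ≉ 0#
      no-root-transfer no-root x fx≈0 = no-root (α · x + β)
        (x·y≈0⇒y≈0 μ≉0 (trans (sym (eval-relation x)) (trans (*-congˡ fx≈0) (zeroʳ κ))))

    module PrimitiveCubeRootOfUnity {ω : Carrier} (ω²+ω+1≈0 : ω ↑ 2 + ω + 1# ≈ 0#) where

      ω³≈1 : ω ↑ 3 ≈ 1#
      ω³≈1 = ≈-by-multiple (ω + 1#) _ ω²+ω+1≈0
        (solve 1 (λ ω → ω :^ 3 :+ con true := (ω :+ con true) :* (ω :^ 2 :+ ω :+ con true)) refl ω)

      [ω²]³≈1 : (ω ↑ 2) ↑ 3 ≈ 1#
      [ω²]³≈1 = trans (solve 1 (λ ω → (ω :^ 2) :^ 3 := (ω :^ 3) :^ 2) refl ω) (trans (^-congˡ 2 ω³≈1) (1↑n≈1 2))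

      1+ω≈ω² : 1# + ω ≈ ω ↑ 2
      1+ω≈ω² = ≈-by-multiple 1# _ ω²+ω+1≈0
        (solve 1 (λ ω → (con true :+ ω) :+ ω :^ 2 := con true :* (ω :^ 2 :+ ω :+ con true)) refl ω)

      1+ω²≈ω : 1# + ω ↑ 2 ≈ ω
      1+ω²≈ω = ≈-by-multiple 1# _ ω²+ω+1≈0
        (solve 1 (λ ω → (con true :+ ω :^ 2) :+ ω := con true :* (ω :^ 2 :+ ω :+ con true)) refl ω)

      ω+ω²≈1 : ω + ω ↑ 2 ≈ 1#
      ω+ω²≈1 = ≈-by-multiple 1# _ ω²+ω+1≈0
        (solve 1 (λ ω → (ω :+ ω :^ 2) :+ con true := con true :* (ω :^ 2 :+ ω :+ con true)) refl ω)


  module Frobenius (F : IsField) (m : ℕ) (H : HasCard (2 ℕ.^ m ℕ.* 2 ℕ.^ m)) (1+1≈0 : 1# + 1# ≈ 0#) where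
    open Field F
    open Char2 1+1≈0
    open Char2Field F (Finite._≟_ H) 1+1≈0

    q : ℕ
    q = 2 ℕ.^ m

    φ : Carrier → Carrier
    φ x = x ↑ q

    φ-cong : ∀ {x y} → x ≈ y → φ x ≈ φ y
    φ-cong = ^-congˡ q

    φ-+ : ∀ x y → φ (x + y) ≈ φ x + φ y
    φ-+ = [x+y]↑2^k m

    φ-· : ∀ x y → φ (x · y) ≈ φ x · φ y
    φ-· x y = ^-distrib-* x y q

    φ-1 : φ 1# ≈ 1#
    φ-1 = 1↑n≈1 q

    φ-↑ : ∀ x n → φ (x ↑ n) ≈ φ x ↑ n
    φ-↑ x n = ↑-comm x n q

    φ-involutive : ∀ x → φ (φ x) ≈ x
    φ-involutive x = trans (^-assocʳ x q q) (fermat F H x)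

    φ-inverse : ∀ {x y} → x · y ≈ 1# → φ x · φ y ≈ 1#
    φ-inverse {x} {y} xy≈1 = trans (sym (φ-· x y)) (trans (φ-cong xy≈1) φ-1)

    φ-root-of-unity : ∀ {ζ s r} → ζ ↑ 3 ≈ 1# → q ≡ 3 ℕ.* s ℕ.+ r → φ ζ ≈ ζ ↑ r
    φ-root-of-unity {ζ} {s} {r} ζ³≈1 q≡3s+r = begin
      ζ ↑ q                  ≡⟨ ≡.cong (ζ ↑_) q≡3s+r ⟩
      ζ ↑ (3 ℕ.* s ℕ.+ r)    ≈⟨ ^-homo-* ζ (3 ℕ.* s) r ⟩
      ζ ↑ (3 ℕ.* s) · ζ ↑ r  ≈⟨ *-congʳ (^-assocʳ ζ 3 s) ⟨
      (ζ ↑ 3) ↑ s · ζ ↑ r    ≈⟨ *-congʳ (trans (^-congˡ s ζ³≈1) (1↑n≈1 s)) ⟩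
      1# · ζ ↑ r             ≈⟨ *-identityˡ _ ⟩
      ζ ↑ r                  ∎

    FrobeniusAction : Carrier → Carrier → Set ℓ
    FrobeniusAction C D = ((∃ λ s → q ≡ 3 ℕ.* s ℕ.+ 1) × φ C ≈ C) ⊎ ((∃ λ s → q ≡ 3 ℕ.* s ℕ.+ 2) × φ C ≈ D)

    -- ζ := φ(y) / y is a cube root of unity with φ ζ ≈ ζ⁻¹, and φ ζ ≈ ζ since q ≡ 1 (mod 3)
    φ-cube-root-fixed : ∀ {s C y u} → q ≡ 3 ℕ.* s ℕ.+ 1 → φ C ≈ C → y ↑ 3 ≈ C → y · u ≈ 1# → φ y ≈ y
    φ-cube-root-fixed {s} {C} {y} {u} q≡3s+1 φC≈C y³≈C yu≈1 = begin
      φ y              ≈⟨ solve 3 (λ Y y u → Y := (Y :* u) :* y :+ Y :* (y :* u :+ con true)) refl (φ y) y u ⟩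
      ζ · y + φ y · (y · u + 1#) ≈⟨ +-cong (*-congʳ ζ≈1) (trans (*-congˡ (x≈y⇒x+y≈0 yu≈1)) (zeroʳ _)) ⟩
      1# · y + 0#      ≈⟨ trans (+-identityʳ _) (*-identityˡ y) ⟩
      y                ∎
      where
      ζ : Carrier
      ζ = φ y · u
      ζ³≈1 : ζ ↑ 3 ≈ 1#
      ζ³≈1 = begin
        (φ y · u) ↑ 3        ≈⟨ ^-distrib-* (φ y) u 3 ⟩
        φ y ↑ 3 · u ↑ 3      ≈⟨ *-congʳ (trans (sym (φ-↑ y 3)) (trans (φ-cong y³≈C) (trans φC≈C (sym y³≈C)))) ⟩
        y ↑ 3 · u ↑ 3        ≈⟨ ^-distrib-* y u 3 ⟨
        (y · u) ↑ 3          ≈⟨ trans (^-congˡ 3 yu≈1) (1↑n≈1 3) ⟩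
        1#                   ∎
      ζ²≈1 : ζ ↑ 2 ≈ 1#
      ζ²≈1 = begin
        ζ ↑ 2                        ≈⟨ solve 1 (λ ζ → ζ :^ 2 := ζ :* ζ :^ 1) refl ζ ⟩
        ζ · ζ ↑ 1                    ≈⟨ *-congˡ (φ-root-of-unity {s = s} {r = 1} ζ³≈1 q≡3s+1) ⟨
        (φ y · u) · φ (φ y · u)      ≈⟨ *-congˡ (trans (φ-· (φ y) u) (*-congʳ (φ-involutive y))) ⟩
        (φ y · u) · (y · φ u)        ≈⟨ solve 4 (λ Y u y U → (Y :* u) :* (y :* U) := (Y :* U) :* (y :* u)) refl (φ y) u y (φ u) ⟩
        (φ y · φ u) · (y · u)        ≈⟨ *-cong (φ-inverse yu≈1) yu≈1 ⟩
        1# · 1#                      ≈⟨ *-identityʳ 1# ⟩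
        1#                           ∎
      ζ≈1 : ζ ≈ 1#
      ζ≈1 = x²≈1⇒x≈1 ζ²≈1

    -- ζ := φ(y) · y is a cube root of unity with φ ζ ≈ ζ, and φ ζ ≈ ζ² since q ≡ 2 (mod 3)
    φ-cube-root-inverted : ∀ {s C D y u} → q ≡ 3 ℕ.* s ℕ.+ 2 → φ C ≈ D → C · D ≈ 1# →
                           y ↑ 3 ≈ C → y · u ≈ 1# → φ y ≈ u
    φ-cube-root-inverted {s} {C} {D} {y} {u} q≡3s+2 φC≈D CD≈1 y³≈C yu≈1 = begin
      φ y              ≈⟨ solve 3 (λ Y y u → Y := (Y :* y) :* u :+ Y :* (y :* u :+ con true)) refl (φ y) y u ⟩
      ζ · u + φ y · (y · u + 1#) ≈⟨ +-cong (*-congʳ ζ≈1) (trans (*-congˡ (x≈y⇒x+y≈0 yu≈1)) (zeroʳ _)) ⟩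
      1# · u + 0#      ≈⟨ trans (+-identityʳ _) (*-identityˡ u) ⟩
      u                ∎
      where
      ζ : Carrier
      ζ = φ y · y
      ζ³≈1 : ζ ↑ 3 ≈ 1#
      ζ³≈1 = begin
        (φ y · y) ↑ 3        ≈⟨ ^-distrib-* (φ y) y 3 ⟩
        φ y ↑ 3 · y ↑ 3      ≈⟨ *-cong (trans (sym (φ-↑ y 3)) (trans (φ-cong y³≈C) φC≈D)) y³≈C ⟩
        D · C                ≈⟨ trans (*-comm D C) CD≈1 ⟩
        1#                   ∎
      ζ≉0 : ζ ≉ 0#
      ζ≉0 = x·y≈1⇒x≉0 (trans (solve 1 (λ ζ → ζ :* ζ :^ 2 := ζ :^ 3) refl ζ) ζ³≈1)
      ζ≈1 : ζ ≈ 1#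
      ζ≈1 = ·-cancelˡ ζ≉0 (begin
        ζ · ζ                        ≈⟨ solve 1 (λ ζ → ζ :* ζ := ζ :^ 2) refl ζ ⟩
        ζ ↑ 2                        ≈⟨ φ-root-of-unity {s = s} {r = 2} ζ³≈1 q≡3s+2 ⟨
        φ (φ y · y)                  ≈⟨ trans (φ-· (φ y) y) (trans (*-congʳ (φ-involutive y)) (*-comm y (φ y))) ⟩
        ζ                            ≈⟨ *-identityʳ ζ ⟨
        ζ · 1#                       ∎)

    module _ {C D y u : Carrier} (CD≈1 : C · D ≈ 1#) (y³≈C : y ↑ 3 ≈ C) (yu≈1 : y · u ≈ 1#) where
      open CubeRoot yu≈1

      φ-ρ : ∀ p → φ (ρ p) ≈ φ p · φ y + φ p ↑ 2 · φ u
      φ-ρ p = trans (φ-+ _ _) (+-cong (φ-· p y) (trans (φ-· _ u) (*-congʳ (φ-↑ p 2))))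

      ρ∈F : ∀ {p} → FrobeniusAction C D → p ↑ 3 ≈ 1# → InSub m (ρ p)
      ρ∈F {p} (inj₁ ((s , q≡3s+1) , φC≈C)) p³≈1 = begin
        φ (ρ p)                         ≈⟨ φ-ρ p ⟩
        φ p · φ y + φ p ↑ 2 · φ u       ≈⟨ +-cong (*-cong φp≈p φy≈y) (*-cong (^-congˡ 2 φp≈p) φu≈u) ⟩
        ρ p                             ∎
        where
        φp≈p : φ p ≈ p
        φp≈p = trans (φ-root-of-unity {s = s} {r = 1} p³≈1 q≡3s+1) (*-identityʳ p)
        φy≈y : φ y ≈ y
        φy≈y = φ-cube-root-fixed {s = s} q≡3s+1 φC≈C y³≈C yu≈1
        φu≈u : φ u ≈ u
        φu≈u = inverse-unique (trans (*-congʳ (sym φy≈y)) (φ-inverse yu≈1)) yu≈1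
      ρ∈F {p} (inj₂ ((s , q≡3s+2) , φC≈D)) p³≈1 = begin
        φ (ρ p)                         ≈⟨ φ-ρ p ⟩
        φ p · φ y + φ p ↑ 2 · φ u       ≈⟨ +-cong (*-cong φp≈p² φy≈u) (*-cong (^-congˡ 2 φp≈p²) φu≈y) ⟩
        p ↑ 2 · u + (p ↑ 2) ↑ 2 · y     ≈⟨ +-comm _ _ ⟩
        (p ↑ 2) ↑ 2 · y + p ↑ 2 · u     ≈⟨ +-congʳ (*-congʳ p⁴≈p) ⟩
        ρ p                             ∎
        where
        φp≈p² : φ p ≈ p ↑ 2
        φp≈p² = φ-root-of-unity {s = s} {r = 2} p³≈1 q≡3s+2
        φy≈u : φ y ≈ u
        φy≈u = φ-cube-root-inverted {s = s} q≡3s+2 φC≈D CD≈1 y³≈C yu≈1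
        φu≈y : φ u ≈ y
        φu≈y = inverse-unique (trans (*-congʳ (sym φy≈u)) (φ-inverse yu≈1)) (trans (*-comm u y) yu≈1)
        p⁴≈p : (p ↑ 2) ↑ 2 ≈ p
        p⁴≈p = trans (solve 1 (λ p → (p :^ 2) :^ 2 := p :^ 3 :* p) refl p) (trans (*-congʳ p³≈1) (*-identityˡ p))

    cubic-three-roots : ∀ {ω C D A} → ω ↑ 2 + ω + 1# ≈ 0# → C · D ≈ 1# → C + D ≈ A → A ≉ 0# →
                        FrobeniusAction C D → IsCube C → ThreeDistinctRoots m (cubic A)
    cubic-three-roots {ω} {C} {D} {A} ω²+ω+1≈0 CD≈1 C+D≈A A≉0 action (y , y³≈C) =
      ρ 1# , ρ ω , ρ (ω ↑ 2) ,
      ρ∈F′ 1³≈1 , ρ∈F′ ω³≈1 , ρ∈F′ [ω²]³≈1 ,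
      ρ-injective (trans (^-congˡ 3 1+ω≈ω²) [ω²]³≈1) y³+u³≉0 ,
      ρ-injective (trans (^-congˡ 3 1+ω²≈ω) ω³≈1) y³+u³≉0 ,
      ρ-injective (trans (^-congˡ 3 ω+ω²≈1) 1³≈1) y³+u³≉0 ,
      ρ-root-of-cubic 1³≈1 , ρ-root-of-cubic ω³≈1 , ρ-root-of-cubic [ω²]³≈1
      where
      open PrimitiveCubeRootOfUnity ω²+ω+1≈0
      1³≈1 : 1# ↑ 3 ≈ 1#
      1³≈1 = 1↑n≈1 3
      y≉0 : y ≉ 0#
      y≉0 y≈0 = x·y≈1⇒x≉0 CD≈1 (trans (sym y³≈C) (trans (^-congˡ 3 y≈0) (zeroˡ _)))
      u : Carrier
      u = inv y y≉0
      yu≈1 : y · u ≈ 1#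
      yu≈1 = x·inv≈1 y y≉0
      open CubeRoot yu≈1
      y³+u³≈A : y ↑ 3 + u ↑ 3 ≈ A
      y³+u³≈A = trans (+-cong y³≈C (inverse-unique C·u³≈1 CD≈1)) C+D≈A
        where
        C·u³≈1 : C · u ↑ 3 ≈ 1#
        C·u³≈1 = trans (*-congʳ (sym y³≈C)) (trans (sym (^-distrib-* y u 3)) (trans (^-congˡ 3 yu≈1) (1↑n≈1 3)))
      y³+u³≉0 : y ↑ 3 + u ↑ 3 ≉ 0#
      y³+u³≉0 y³+u³≈0 = A≉0 (trans (sym y³+u³≈A) y³+u³≈0)
      ρ-root-of-cubic : ∀ {p} → p ↑ 3 ≈ 1# → eval (cubic A) (ρ p) ≈ 0#
      ρ-root-of-cubic p³≈1 = root-of-cubic (trans (ρ-root p³≈1) y³+u³≈A)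
      ρ∈F′ : ∀ {p} → p ↑ 3 ≈ 1# → InSub m (ρ p)
      ρ∈F′ = ρ∈F CD≈1 y³≈C yu≈1 action

  module Setting (m : ℕ) (m≥1 : 1 ≤ m) (F : IsField) (H : HasCard (2 ℕ.^ m ℕ.* 2 ℕ.^ m))
                 {a b ω c : Carrier} (a∈F : InSub m a) (a≉0 : a ≉ 0#) (a≉1 : a ≉ 1#)
                 (a[b²+b+1]≈1 : a · (b ↑ 2 + b + 1#) ≈ 1#) (b∈F : InSub m b)
                 (ω∈F₄ : InSub 2 ω) (ω∉F₂ : ¬ InSub 1 ω) (c[b+ω²]≈b+ω : c · (b + ω ↑ 2) ≈ b + ω) where
    open Field F
    open Subfield F

    1+1≈0 : 1# + 1# ≈ 0#
    1+1≈0 with [2^m]²-even m≥1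
    ... | k , q²≡2k = even-card⇒1+1≈0 F {k} (≡.subst HasCard q²≡2k H)

    open Char2 1+1≈0
    open Char2Field F (Finite._≟_ H) 1+1≈0 public
    open Polynomials F (Finite._≟_ H) public
    open Frobenius F m H 1+1≈0 public

    ω²+ω+1≈0 : ω ↑ 2 + ω + 1# ≈ 0#
    ω²+ω+1≈0 = x·y≈0⇒y≈0 ω+1≉0 (x·y≈0⇒y≈0 ω≉0 (≈-by-multiple 1# _ (x≈y⇒x+y≈0 ω∈F₄)
      (solve 1 (λ ω → ω :* ((ω :+ con true) :* (ω :^ 2 :+ ω :+ con true)) :+ con false
                    := con true :* (ω :^ 4 :+ ω)) refl ω)))
      where
      ω≉0 : ω ≉ 0#
      ω≉0 ω≈0 = ω∉F₂ (trans (^-congˡ 2 ω≈0) (trans (zeroˡ _) (sym ω≈0)))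
      ω+1≉0 : ω + 1# ≉ 0#
      ω+1≉0 ω+1≈0 = ω∉F₂ (trans (^-congˡ 2 ω≈1) (trans (1↑n≈1 2) (sym ω≈1)))
        where
        ω≈1 : ω ≈ 1#
        ω≈1 = x+y≈0⇒x≈y ω+1≈0

    open PrimitiveCubeRootOfUnity ω²+ω+1≈0

    [b+ω][b+ω²]≈b²+b+1 : (b + ω) · (b + ω ↑ 2) ≈ b ↑ 2 + b + 1#
    [b+ω][b+ω²]≈b²+b+1 = ≈-by-multiple (b + ω + 1#) _ ω²+ω+1≈0
      (solve 2 (λ b ω → (b :+ ω) :* (b :+ ω :^ 2) :+ (b :^ 2 :+ b :+ con true)
                     := (b :+ ω :+ con true) :* (ω :^ 2 :+ ω :+ con true)) refl b ω)

    c≈a[b+ω]² : c ≈ a · (b + ω) ↑ 2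
    c≈a[b+ω]² = begin
      c                                   ≈⟨ *-identityʳ c ⟨
      c · 1#                              ≈⟨ *-congˡ (trans (*-congˡ [b+ω][b+ω²]≈b²+b+1) a[b²+b+1]≈1) ⟨
      c · (a · ((b + ω) · (b + ω ↑ 2)))   ≈⟨ solve 4 (λ c a x y → c :* (a :* (x :* y)) := a :* x :* (c :* y)) refl c a (b + ω) (b + ω ↑ 2) ⟩
      a · (b + ω) · (c · (b + ω ↑ 2))     ≈⟨ *-congˡ c[b+ω²]≈b+ω ⟩
      a · (b + ω) · (b + ω)               ≈⟨ solve 2 (λ a x → a :* x :* x := a :* x :^ 2) refl a (b + ω) ⟩
      a · (b + ω) ↑ 2                     ∎

    c̄ : Carrier
    c̄ = a · (b + ω ↑ 2) ↑ 2

    c·c̄≈1 : c · c̄ ≈ 1#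
    c·c̄≈1 = begin
      c · c̄                                        ≈⟨ *-congʳ c≈a[b+ω]² ⟩
      a · (b + ω) ↑ 2 · (a · (b + ω ↑ 2) ↑ 2)      ≈⟨ solve 3 (λ a x y → a :* x :^ 2 :* (a :* y :^ 2) := (a :* (x :* y)) :^ 2) refl a (b + ω) (b + ω ↑ 2) ⟩
      (a · ((b + ω) · (b + ω ↑ 2))) ↑ 2           ≈⟨ ^-congˡ 2 (trans (*-congˡ [b+ω][b+ω²]≈b²+b+1) a[b²+b+1]≈1) ⟩
      1# ↑ 2                                       ≈⟨ 1↑n≈1 2 ⟩
      1#                                           ∎

    C D A : Fin 3 → Carrier
    C i = ω ↑ toℕ i · c
    D i = (ω ↑ 2) ↑ toℕ i · c̄
    A Fin.zero = a
    A (Fin.suc Fin.zero) = a · b ↑ 2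
    A (Fin.suc (Fin.suc Fin.zero)) = a · (b + 1#) ↑ 2

    C·D≈1 : ∀ i → C i · D i ≈ 1#
    C·D≈1 i = begin
      ω ↑ n · c · ((ω ↑ 2) ↑ n · c̄)    ≈⟨ solve 4 (λ X Y c d → X :* c :* (Y :* d) := X :* Y :* (c :* d)) refl _ _ c c̄ ⟩
      ω ↑ n · (ω ↑ 2) ↑ n · (c · c̄)    ≈⟨ *-cong (sym (^-distrib-* ω (ω ↑ 2) n)) c·c̄≈1 ⟩
      (ω · ω ↑ 2) ↑ n · 1#             ≈⟨ *-identityʳ _ ⟩
      (ω · ω ↑ 2) ↑ n                  ≈⟨ ^-congˡ n (trans (solve 1 (λ ω → ω :* ω :^ 2 := ω :^ 3) refl ω) ω³≈1) ⟩
      1# ↑ n                           ≈⟨ 1↑n≈1 n ⟩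
      1#                               ∎
      where
      n : ℕ
      n = toℕ i

    C+D≈A : ∀ i → C i + D i ≈ A i
    C+D≈A i = trans (+-congʳ (*-congˡ c≈a[b+ω]²)) (by-cases i)
      where
      t : Carrier
      t = ω ↑ 2 + ω + 1#
      by-cases : ∀ i → ω ↑ toℕ i · (a · (b + ω) ↑ 2) + D i ≈ A i
      by-cases Fin.zero = ≈-by-multiple (a · t) t ω²+ω+1≈0
        (solve 3 (λ a b ω → (ω :^ 0 :* (a :* (b :+ ω) :^ 2) :+ (ω :^ 2) :^ 0 :* (a :* (b :+ ω :^ 2) :^ 2)) :+ a
                        := (a :* (ω :^ 2 :+ ω :+ con true)) :* (ω :^ 2 :+ ω :+ con true)) refl a b ω)
      by-cases (Fin.suc Fin.zero) = ≈-by-multiple (a · (b ↑ 2 + ω ↑ 3 · (ω + 1#))) t ω²+ω+1≈0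
        (solve 3 (λ a b ω → (ω :^ 1 :* (a :* (b :+ ω) :^ 2) :+ (ω :^ 2) :^ 1 :* (a :* (b :+ ω :^ 2) :^ 2)) :+ a :* b :^ 2
                        := (a :* (b :^ 2 :+ ω :^ 3 :* (ω :+ con true))) :* (ω :^ 2 :+ ω :+ con true)) refl a b ω)
      by-cases (Fin.suc (Fin.suc Fin.zero)) = ≈-by-multiple (a · (b ↑ 2 · t + t ↑ 3)) t ω²+ω+1≈0
        (solve 3 (λ a b ω → (ω :^ 2 :* (a :* (b :+ ω) :^ 2) :+ (ω :^ 2) :^ 2 :* (a :* (b :+ ω :^ 2) :^ 2)) :+ a :* (b :+ con true) :^ 2
                        := (a :* (b :^ 2 :* (ω :^ 2 :+ ω :+ con true) :+ (ω :^ 2 :+ ω :+ con true) :^ 3))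
                           :* (ω :^ 2 :+ ω :+ con true)) refl a b ω)

    φ[ω↑n·c] : ∀ n → φ (ω ↑ n · c) ≈ φ ω ↑ n · a · (b + φ ω) ↑ 2
    φ[ω↑n·c] n = begin
      φ (ω ↑ n · c)                            ≈⟨ φ-· _ c ⟩
      φ (ω ↑ n) · φ c                          ≈⟨ *-cong (φ-↑ ω n) (φ-cong c≈a[b+ω]²) ⟩
      φ ω ↑ n · φ (a · (b + ω) ↑ 2)            ≈⟨ *-congˡ (trans (φ-· a _) (*-cong a∈F (φ-↑ (b + ω) 2))) ⟩
      φ ω ↑ n · (a · φ (b + ω) ↑ 2)            ≈⟨ *-congˡ (*-congˡ (^-congˡ 2 (trans (φ-+ b ω) (+-congʳ b∈F)))) ⟩
      φ ω ↑ n · (a · (b + φ ω) ↑ 2)            ≈⟨ *-assoc _ _ _ ⟨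
      φ ω ↑ n · a · (b + φ ω) ↑ 2              ∎

    action : ∀ i → FrobeniusAction (C i) (D i)
    action i with 2^k-mod-3 m
    ... | inj₁ (s , q≡3s+1) = inj₁ ((s , q≡3s+1) , (begin
      φ (ω ↑ n · c)                     ≈⟨ φ[ω↑n·c] n ⟩
      φ ω ↑ n · a · (b + φ ω) ↑ 2       ≈⟨ *-cong (*-congʳ (^-congˡ n φω≈ω)) (^-congˡ 2 (+-congˡ φω≈ω)) ⟩
      ω ↑ n · a · (b + ω) ↑ 2           ≈⟨ trans (*-congˡ c≈a[b+ω]²) (sym (*-assoc _ _ _)) ⟨
      ω ↑ n · c                         ∎))
      where
      n : ℕ
      n = toℕ i
      φω≈ω : φ ω ≈ ω
      φω≈ω = trans (φ-root-of-unity {s = s} {r = 1} ω³≈1 q≡3s+1) (*-identityʳ ω)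
    ... | inj₂ (s , q≡3s+2) = inj₂ ((s , q≡3s+2) , (begin
      φ (ω ↑ n · c)                     ≈⟨ φ[ω↑n·c] n ⟩
      φ ω ↑ n · a · (b + φ ω) ↑ 2       ≈⟨ *-cong (*-congʳ (^-congˡ n φω≈ω²)) (^-congˡ 2 (+-congˡ φω≈ω²)) ⟩
      (ω ↑ 2) ↑ n · a · (b + ω ↑ 2) ↑ 2 ≈⟨ *-assoc _ _ _ ⟩
      (ω ↑ 2) ↑ n · c̄                   ∎))
      where
      n : ℕ
      n = toℕ i
      φω≈ω² : φ ω ≈ ω ↑ 2
      φω≈ω² = φ-root-of-unity {s = s} {r = 2} ω³≈1 q≡3s+2

    t≉0 : ∀ {t} → a · (t ↑ 2 + t + 1#) ≈ 1# → t ≉ 0#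
    t≉0 {t} a[t²+t+1]≈1 t≈0 = a≉1 (begin
      a                      ≈⟨ *-identityʳ a ⟨
      a · 1#                 ≈⟨ *-congˡ (solve 0 (con false :^ 2 :+ con false :+ con true := con true) refl) ⟨
      a · (0# ↑ 2 + 0# + 1#) ≈⟨ *-congˡ (+-congʳ (+-cong (^-congˡ 2 t≈0) t≈0)) ⟨
      a · (t ↑ 2 + t + 1#)   ≈⟨ a[t²+t+1]≈1 ⟩
      1#                     ∎)

    -- with e = t² + t + 1 ≈ a⁻¹:  t⁴ f(x) + a g(t² x + e) = (a e + 1)(t⁴ x² + a t² (t + 1)² e)
    relation : ∀ {t} → InSub m t → a · (t ↑ 2 + t + 1#) ≈ 1# →
      AffinelyRelated m ((a ↑ 2) · (t ↑ 4) ∷ a · ((t + 1#) ↑ 2) ∷ 1# ∷ a · (t ↑ 2) ∷ []) (cubic (a · t ↑ 2))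
    relation {t} t∈F a[t²+t+1]≈1 = record
      { κ = t ↑ 4 ; μ = a ; α = t ↑ 2 ; β = t ↑ 2 + t + 1#
      ; κ≉0 = ↑-nonzero 4 (t≉0 a[t²+t+1]≈1) ; μ≉0 = a≉0 ; α≉0 = ↑-nonzero 2 (t≉0 a[t²+t+1]≈1)
      ; α∈F = ↑∈F m 2 t∈F ; β∈F = +∈F m (+∈F m (↑∈F m 2 t∈F) t∈F) (1∈F m)
      ; eval-relation = λ x → ≈-by-multiple _ _ (x≈y⇒x+y≈0 a[t²+t+1]≈1)
          (solve 3 (λ a t x →
              t :^ 4 :* (a :^ 2 :* t :^ 4 :+ x :* (a :* (t :+ con true) :^ 2 :+ x :* (con true :+ x :* (a :* t :^ 2 :+ x :* con false))))
              :+ a :* (a :* t :^ 2 :+ (t :^ 2 :* x :+ (t :^ 2 :+ t :+ con true))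
                       :* (con true :+ (t :^ 2 :* x :+ (t :^ 2 :+ t :+ con true))
                       :* (con false :+ (t :^ 2 :* x :+ (t :^ 2 :+ t :+ con true)) :* (con true :+ (t :^ 2 :* x :+ (t :^ 2 :+ t :+ con true)) :* con false))))
            := (t :^ 4 :* x :^ 2 :+ a :* t :^ 2 :* (t :+ con true) :^ 2 :* (t :^ 2 :+ t :+ con true))
               :* (a :* (t :^ 2 :+ t :+ con true) :+ con true)) refl a t x) }

    a[[b+1]²+[b+1]+1]≈1 : a · ((b + 1#) ↑ 2 + (b + 1#) + 1#) ≈ 1#
    a[[b+1]²+[b+1]+1]≈1 = trans (*-congˡ (solve 1 (λ b → (b :+ con true) :^ 2 :+ (b :+ con true) :+ con true
                                                   := b :^ 2 :+ b :+ con true) refl b)) a[b²+b+1]≈1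

    related : ∀ i → AffinelyRelated m (fpoly a b i) (cubic (A i))
    related Fin.zero = record
      { κ = 1# ; μ = 1# ; α = 1# ; β = 0# ; κ≉0 = 1≉0 ; μ≉0 = 1≉0 ; α≉0 = 1≉0 ; α∈F = 1∈F m ; β∈F = 0∈F m
      ; eval-relation = λ x → *-congˡ (eval-resp-≈ (cubic a) (sym (trans (+-identityʳ _) (*-identityˡ x)))) }
    related (Fin.suc Fin.zero) = relation b∈F a[b²+b+1]≈1
    related (Fin.suc (Fin.suc Fin.zero)) =
      AffinelyRelated-resp-≃ (relation (+∈F m b∈F (1∈F m)) a[[b+1]²+[b+1]+1]≈1) λ where
        (suc zero) → *-congˡ (^-congˡ 2 (solve 1 (λ b → b :+ con true :+ con true := b) refl b))
        zero → refl
        (suc (suc zero)) → refl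
        (suc (suc (suc zero))) → refl
        (suc (suc (suc (suc n)))) → refl

    lead≉0 : ∀ i → coeff (fpoly a b i) 3 ≉ 0#
    lead≉0 Fin.zero = 1≉0
    lead≉0 (Fin.suc Fin.zero) = ·-nonzero a≉0 (↑-nonzero 2 (t≉0 a[b²+b+1]≈1))
    lead≉0 (Fin.suc (Fin.suc Fin.zero)) = ·-nonzero a≉0 (↑-nonzero 2 (t≉0 a[[b+1]²+[b+1]+1]≈1))

    A≉0 : ∀ i → A i ≉ 0#
    A≉0 Fin.zero = a≉0
    A≉0 i@(Fin.suc Fin.zero) = lead≉0 i
    A≉0 i@(Fin.suc (Fin.suc Fin.zero)) = lead≉0 i

    degree : ∀ i → HasDegree (fpoly a b i) 3 (coeff (fpoly a b i) 3)
    degree Fin.zero = cubic-degree _ _ _ _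
    degree (Fin.suc Fin.zero) = cubic-degree _ _ _ _
    degree (Fin.suc (Fin.suc Fin.zero)) = cubic-degree _ _ _ _

-- The trace condition only guarantees that b² + b + 1 = 1/a is solvable in 𝔽_q.
lemma5p1 : ∀ {c ℓ : Level} (L : CommutativeRing c ℓ) (m : ℕ) → 1 ≤ m →
    let open CommutativeRing L renaming (_*_ to _·_)
        open FF L renaming (_^_ to _↑_)
        q = 2 ℕ.^ m
    in IsField → HasCard (q ℕ.* q) →
    (a a⁻¹ b ω c : Carrier) →
    InSub m a → ¬ (a ≈ 0#) → ¬ (a ≈ 1#) → a · a⁻¹ ≈ 1# →
    Tr m a⁻¹ ≈ Tr m 1# →
    InSub m b → (b ↑ 2) + b + 1# ≈ a⁻¹ →
    InSub 2 ω → ¬ InSub 1 ω →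
    c · (b + (ω ↑ 2)) ≈ b + ω →
    (i : Fin 3) →
      (IsCube ((ω ↑ toℕ i) · c) → ThreeDistinctRoots m (fpoly a b i)) ×
      (¬ IsCube ((ω ↑ toℕ i) · c) → Irreducible m (fpoly a b i))
lemma5p1 L m m≥1 F H a a⁻¹ b ω c a∈F a≉0 a≉1 aa⁻¹≈1 _ b∈F b²+b+1≈a⁻¹ ω∈F₄ ω∉F₂ c[b+ω²]≈b+ω i =
    (λ cube → ThreeDistinctRoots-transfer (related i)
                (cubic-three-roots ω²+ω+1≈0 (C·D≈1 i) (C+D≈A i) (A≉0 i) (action i) cube))
  , (λ ¬cube → cubic-irreducible m (fpoly a b i) (degree i) (lead≉0 i)
                 (no-root-transfer (related i) (cubic-no-root (C·D≈1 i) (C+D≈A i) (A≉0 i) ¬cube)))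
  where
  open CommutativeRing L using (trans; *-congˡ)
  open FF L using (fpoly)
  open Setting L m m≥1 F H a∈F a≉0 a≉1 (trans (*-congˡ b²+b+1≈a⁻¹) aa⁻¹≈1) b∈F ω∈F₄ ω∉F₂ c[b+ω²]≈b+ω
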